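{- Let $a(n,k)=\binom{n}{k}\binom{2n-2k}{n-k}$ for $0\leq k\leq n$ and $a(n,k)=0$ otherwise. For any integers $n\geq 1$ and $0\leq t\leq n$, $$a(n+1,0)a(n-1,t)+a(n-1,0)a(n+1,t)-2a(n,0)a(n,t)\geq 0.$$ -}

module Defs where

open import Data.Nat using (ℕ; _*_; _∸_; _≤?_)
open import Data.Nat.Combinatorics using (_C_)
open import Relation.Nullary using (yes; no)

a : ℕ → ℕ → ℕ
a n k with k ≤? n
... | yes _ = (n C k) * ((2 * n ∸ 2 * k) C (n ∸ k))
... | no _ = 0

-- With m = n − k one has a(n,k) = C(n,k)·C(2m,m), and both factors change by explicit
-- rational factors when n grows by one with k fixed. Dividing the inequality by
-- a(n,0)a(n,t), it therefore becomes 2 ≤ N₁/D₁ + N₂/D₂ for explicit polynomials in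
-- n and t; cleared of denominators, the difference of the two sides has
-- nonnegative coefficients once written in n − 1 − t and t − 1 (t = 0 apart).
-- The case t = n, where a(n−1,t) = 0, reduces to C(2n,n) ≤ (n+1)·C(2n−2,n−1).
module Submission where

open import Defs
open import Data.Nat using (ℕ; zero; suc; _+_; _*_; _∸_; _≤_; _≥_; s≤s; NonZero)
open import Data.Nat.Properties
open import Data.Nat.Combinatorics using (_C_; nC1≡n; nCk+nC[k+1]≡[n+1]C[k+1])
open import Data.Nat.Tactic.RingSolver using (solve-∀)
open import Data.Product using (_,_)
open import Data.Sum using (inj₁; inj₂)
open import Relation.Binary.PropositionalEquality
open import Relation.Nullary using (yes; no)
open import Data.Empty using (⊥-elim)
open import Algebra.Properties.CommutativeSemigroup *-commutativeSemigroup
  using (interchange; x∙yz≈y∙xz)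

-- d · u ≐ n · v says u : v = n : d. Wrapping d * u ≡ n * v in a record lets Agda
-- infer the four factors, which unification cannot recover from a product.
infix 4 _·_≐_·_
record _·_≐_·_ (d u n v : ℕ) : Set where
  constructor scaled
  field scaled-≡ : d * u ≡ n * v
open _·_≐_·_

≐-sym : ∀ {d u n v} → d · u ≐ n · v → n · v ≐ d · u
≐-sym (scaled e) = scaled (sym e)

≐-* : ∀ {d₁ d₂ n₁ n₂ u₁ u₂ v₁ v₂} →
  d₁ · u₁ ≐ n₁ · v₁ → d₂ · u₂ ≐ n₂ · v₂ →
  d₁ * d₂ · u₁ * u₂ ≐ n₁ * n₂ · v₁ * v₂
≐-* {d₁} {d₂} {n₁} {n₂} {u₁} {u₂} {v₁} {v₂} (scaled e₁) (scaled e₂) = scaled (begin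
  (d₁ * d₂) * (u₁ * u₂)  ≡⟨ interchange d₁ d₂ u₁ u₂ ⟩
  (d₁ * u₁) * (d₂ * u₂)  ≡⟨ cong₂ _*_ e₁ e₂ ⟩
  (n₁ * v₁) * (n₂ * v₂)  ≡⟨ interchange n₁ v₁ n₂ v₂ ⟩
  (n₁ * n₂) * (v₁ * v₂)  ∎)
  where open ≡-Reasoning

2z≤x₁+x₂-by-proportions : ∀ {d₁ d₂ n₁ n₂ x₁ x₂ z} .{{_ : NonZero (d₁ * d₂)}} →
  d₁ · x₁ ≐ n₁ · z → d₂ · x₂ ≐ n₂ · z →
  2 * (d₁ * d₂) ≤ n₁ * d₂ + n₂ * d₁ →
  2 * z ≤ x₁ + x₂
2z≤x₁+x₂-by-proportions {d₁} {d₂} {n₁} {n₂} {x₁} {x₂} {z} (scaled e₁) (scaled e₂) h =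
  *-cancelˡ-≤ (d₁ * d₂) (begin
    d₁ * d₂ * (2 * z)                ≡⟨ move-2 (d₁ * d₂) z ⟩
    2 * (d₁ * d₂) * z                ≤⟨ *-monoˡ-≤ z h ⟩
    (n₁ * d₂ + n₂ * d₁) * z          ≡⟨ distribute n₁ d₂ n₂ d₁ z ⟩
    d₂ * (n₁ * z) + d₁ * (n₂ * z)    ≡⟨ cong₂ _+_ (cong (d₂ *_) e₁) (cong (d₁ *_) e₂) ⟨
    d₂ * (d₁ * x₁) + d₁ * (d₂ * x₂)  ≡⟨ collect d₁ d₂ x₁ x₂ ⟩
    d₁ * d₂ * (x₁ + x₂)              ∎)
  where
  open ≤-Reasoning
  move-2 : ∀ d z → d * (2 * z) ≡ 2 * d * z
  move-2 = solve-∀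
  distribute : ∀ n₁ d₂ n₂ d₁ z → (n₁ * d₂ + n₂ * d₁) * z ≡ d₂ * (n₁ * z) + d₁ * (n₂ * z)
  distribute = solve-∀
  collect : ∀ d₁ d₂ x₁ x₂ → d₂ * (d₁ * x₁) + d₁ * (d₂ * x₂) ≡ d₁ * d₂ * (x₁ + x₂)
  collect = solve-∀

[k+1]*[n+1]C[k+1]≡[n+1]*nCk : ∀ n k → suc k * (suc n C suc k) ≡ suc n * (n C k)
[k+1]*[n+1]C[k+1]≡[n+1]*nCk zero    zero    = refl
[k+1]*[n+1]C[k+1]≡[n+1]*nCk zero    (suc k) = *-zeroʳ (suc (suc k))
[k+1]*[n+1]C[k+1]≡[n+1]*nCk (suc n) zero    = begin
  1 * (suc (suc n) C 1)  ≡⟨ *-identityˡ _ ⟩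
  suc (suc n) C 1        ≡⟨ nC1≡n (suc (suc n)) ⟩
  suc (suc n)            ≡⟨ *-identityʳ _ ⟨
  suc (suc n) * 1        ∎
  where open ≡-Reasoning
[k+1]*[n+1]C[k+1]≡[n+1]*nCk (suc n) (suc k) = begin
  suc (suc k) * (suc (suc n) C suc (suc k))
    ≡⟨ cong (suc (suc k) *_) (nCk+nC[k+1]≡[n+1]C[k+1] (suc n) (suc k)) ⟨
  suc (suc k) * (X + Y)
    ≡⟨ split (suc k) X Y ⟩
  X + suc k * X + suc (suc k) * Y
    ≡⟨ cong₂ (λ u v → X + u + v) ([k+1]*[n+1]C[k+1]≡[n+1]*nCk n k)
                                 ([k+1]*[n+1]C[k+1]≡[n+1]*nCk n (suc k)) ⟩
  X + suc n * (n C k) + suc n * (n C suc k)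
    ≡⟨ join X (suc n) (n C k) (n C suc k) ⟩
  X + suc n * (n C k + n C suc k)
    ≡⟨ cong (λ u → X + suc n * u) (nCk+nC[k+1]≡[n+1]C[k+1] n k) ⟩
  suc (suc n) * X
    ∎
  where
  open ≡-Reasoning
  X = suc n C suc k
  Y = suc n C suc (suc k)
  split : ∀ k X Y → suc k * (X + Y) ≡ X + k * X + suc k * Y
  split = solve-∀
  join : ∀ X m U V → X + m * U + m * V ≡ X + m * (U + V)
  join = solve-∀

m*nCk≡[k+1]*nC[k+1] : ∀ k m {n} → k + m ≡ n → m * (n C k) ≡ suc k * (n C suc k)
m*nCk≡[k+1]*nC[k+1] k m refl = +-cancelˡ-≡ (suc k * (n C k)) _ _ (begin
  suc k * (n C k) + m * (n C k)          ≡⟨ *-distribʳ-+ (n C k) (suc k) m ⟨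
  suc n * (n C k)                        ≡⟨ [k+1]*[n+1]C[k+1]≡[n+1]*nCk n k ⟨
  suc k * (suc n C suc k)                ≡⟨ cong (suc k *_) (nCk+nC[k+1]≡[n+1]C[k+1] n k) ⟨
  suc k * (n C k + n C suc k)            ≡⟨ *-distribˡ-+ (suc k) (n C k) (n C suc k) ⟩
  suc k * (n C k) + suc k * (n C suc k)  ∎)
  where
  open ≡-Reasoning
  n = k + m

[n+1]*nCk≡[m+1]*[n+1]Ck : ∀ k m {n} → k + m ≡ n → suc n * (n C k) ≡ suc m * (suc n C k)
[n+1]*nCk≡[m+1]*[n+1]Ck k m {n} k+m≡n = begin
  suc n * (n C k)          ≡⟨ [k+1]*[n+1]C[k+1]≡[n+1]*nCk n k ⟨
  suc k * (suc n C suc k)  ≡⟨ m*nCk≡[k+1]*nC[k+1] k (suc m) (trans (+-suc k m) (cong suc k+m≡n)) ⟨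
  suc m * (suc n C k)      ∎
  where open ≡-Reasoning

centralBinom : ℕ → ℕ
centralBinom k = (2 * k) C k

[k+1]*centralBinom[k+1]≡2[2k+1]*centralBinom[k] : ∀ k →
  suc k * centralBinom (suc k) ≡ 2 * suc (2 * k) * centralBinom k
[k+1]*centralBinom[k+1]≡2[2k+1]*centralBinom[k] k = *-cancelˡ-≡ _ _ (suc k) (begin
  suc k * (suc k * ((2 * suc k) C suc k))
    ≡⟨ cong (λ n → suc k * (suc k * (n C suc k))) (*-suc 2 k) ⟩
  suc k * (suc k * (suc (suc (2 * k)) C suc k))
    ≡⟨ cong (suc k *_) ([k+1]*[n+1]C[k+1]≡[n+1]*nCk (suc (2 * k)) k) ⟩
  suc k * (suc (suc (2 * k)) * (suc (2 * k) C k))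
    ≡⟨ x∙yz≈y∙xz (suc k) (suc (suc (2 * k))) (suc (2 * k) C k) ⟩
  suc (suc (2 * k)) * (suc k * (suc (2 * k) C k))
    ≡⟨ cong (suc (suc (2 * k)) *_) ([n+1]*nCk≡[m+1]*[n+1]Ck k k (k+k≡2*k k)) ⟨
  suc (suc (2 * k)) * (suc (2 * k) * centralBinom k)
    ≡⟨ regroup k (centralBinom k) ⟩
  suc k * (2 * suc (2 * k) * centralBinom k)
    ∎)
  where
  open ≡-Reasoning
  k+k≡2*k : ∀ k → k + k ≡ 2 * k
  k+k≡2*k = solve-∀
  regroup : ∀ k c → suc (suc (2 * k)) * (suc (2 * k) * c) ≡ suc k * (2 * suc (2 * k) * c)
  regroup = solve-∀

centralBinom[k+1]≤[k+2]*centralBinom[k] : ∀ k →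
  centralBinom (suc k) ≤ suc (suc k) * centralBinom k
centralBinom[k+1]≤[k+2]*centralBinom[k] k = *-cancelˡ-≤ (suc k) (begin
  suc k * centralBinom (suc k)          ≡⟨ [k+1]*centralBinom[k+1]≡2[2k+1]*centralBinom[k] k ⟩
  2 * suc (2 * k) * centralBinom k      ≤⟨ *-monoˡ-≤ (centralBinom k) (2[2k+1]≤[k+1][k+2] k) ⟩
  suc k * suc (suc k) * centralBinom k  ≡⟨ *-assoc (suc k) (suc (suc k)) (centralBinom k) ⟩
  suc k * (suc (suc k) * centralBinom k) ∎)
  where
  open ≤-Reasoning
  2[2k+1]≤[k+1][k+2] : ∀ k → 2 * suc (2 * k) ≤ suc k * suc (suc k)
  2[2k+1]≤[k+1][k+2] zero    = ≤-refl
  2[2k+1]≤[k+1][k+2] (suc k) = subst (2 * suc (2 * suc k) ≤_) (sym (expand k)) (m≤m+n _ _)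
    where
    expand : ∀ k → suc (suc k) * suc (suc (suc k)) ≡ 2 * suc (2 * suc k) + suc k * k
    expand = solve-∀

a≡C*centralBinom : ∀ k m {n} → k + m ≡ n → a n k ≡ (n C k) * centralBinom m
a≡C*centralBinom k m refl with k ≤? k + m
... | yes _  = cong (((k + m) C k) *_) (cong₂ _C_ 2[k+m]∸2k≡2m (m+n∸m≡n k m))
  where
  2[k+m]∸2k≡2m : 2 * (k + m) ∸ 2 * k ≡ 2 * m
  2[k+m]∸2k≡2m = trans (cong (_∸ 2 * k) (*-distribˡ-+ 2 k m)) (m+n∸m≡n (2 * k) (2 * m))
... | no k≰k+m = ⊥-elim (k≰k+m (m≤m+n k m))

a[n,0]≡centralBinom : ∀ n → a n 0 ≡ centralBinom n
a[n,0]≡centralBinom n = trans (a≡C*centralBinom 0 n refl) (*-identityˡ (centralBinom n))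

a[n+1,0]-ratio : ∀ n → suc n · a (suc n) 0 ≐ 2 * suc (2 * n) · a n 0
a[n+1,0]-ratio n = scaled (begin
  suc n * a (suc n) 0               ≡⟨ cong (suc n *_) (a[n,0]≡centralBinom (suc n)) ⟩
  suc n * centralBinom (suc n)      ≡⟨ [k+1]*centralBinom[k+1]≡2[2k+1]*centralBinom[k] n ⟩
  2 * suc (2 * n) * centralBinom n  ≡⟨ cong (2 * suc (2 * n) *_) (a[n,0]≡centralBinom n) ⟨
  2 * suc (2 * n) * a n 0           ∎)
  where open ≡-Reasoning

a[n+1,k]-ratio : ∀ k m {n} → k + m ≡ n →
  suc n * (2 * suc (2 * m)) · a n k ≐ suc m * suc m · a (suc n) k
a[n+1,k]-ratio k m {n} k+m≡n = scaled (begin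
  suc n * (2 * suc (2 * m)) * a n k
    ≡⟨ cong (suc n * (2 * suc (2 * m)) *_) (a≡C*centralBinom k m k+m≡n) ⟩
  suc n * (2 * suc (2 * m)) * ((n C k) * centralBinom m)
    ≡⟨ scaled-≡ (≐-* binomial-ratio central-ratio) ⟩
  suc m * suc m * ((suc n C k) * centralBinom (suc m))
    ≡⟨ cong (suc m * suc m *_) (a≡C*centralBinom k (suc m) (trans (+-suc k m) (cong suc k+m≡n))) ⟨
  suc m * suc m * a (suc n) k
    ∎)
  where
  open ≡-Reasoning
  binomial-ratio : suc n · n C k ≐ suc m · suc n C k
  binomial-ratio = scaled ([n+1]*nCk≡[m+1]*[n+1]Ck k m k+m≡n)
  central-ratio : 2 * suc (2 * m) · centralBinom m ≐ suc m · centralBinom (suc m)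
  central-ratio = scaled (sym ([k+1]*centralBinom[k+1]≡2[2k+1]*centralBinom[k] m))

-- The remainders have nonnegative coefficients in p and t − 1, but not in p and t.
ratio-sum-≥-2 : ∀ t p →
  let q  = t + p
      d₁ = suc (suc q) * (suc q * (2 * suc (2 * p)))
      n₁ = 2 * suc (2 * suc q) * (suc p * suc p)
      d₂ = 2 * suc (2 * q) * (suc (suc p) * suc (suc p))
      n₂ = suc q * (suc (suc q) * (2 * suc (2 * suc p)))
  in 2 * (d₁ * d₂) ≤ n₁ * d₂ + n₂ * d₁
ratio-sum-≥-2 zero    p = ≤-trans (m≤m+n _ _) (≤-reflexive (sym (certificate p)))
  where
  certificate : ∀ p →
    let d₁ = suc (suc p) * (suc p * (2 * suc (2 * p)))
        n₁ = 2 * suc (2 * suc p) * (suc p * suc p)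
        d₂ = 2 * suc (2 * p) * (suc (suc p) * suc (suc p))
        n₂ = suc p * (suc (suc p) * (2 * suc (2 * suc p)))
    in n₁ * d₂ + n₂ * d₁ ≡ 2 * (d₁ * d₂) + 4 * (8 + p * (32 + p * (42 + p * (22 + p * 4))))
  certificate = solve-∀
ratio-sum-≥-2 (suc s) p = ≤-trans (m≤m+n _ _) (≤-reflexive (sym (certificate s p)))
  where
  certificate : ∀ s p →
    let q  = suc (s + p)
        d₁ = suc (suc q) * (suc q * (2 * suc (2 * p)))
        n₁ = 2 * suc (2 * suc q) * (suc p * suc p)
        d₂ = 2 * suc (2 * q) * (suc (suc p) * suc (suc p))
        n₂ = suc q * (suc (suc q) * (2 * suc (2 * suc p)))
    in n₁ * d₂ + n₂ * d₁ ≡ 2 * (d₁ * d₂) + 4 *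
         (      (24 + s * (28 + s * (23 + s * (14 + s * 3))))
          + p * ((64 + s * (70 + s * (74 + s * (44 + s * 8))))
          + p * ((62 + s * (68 + s * (80 + s * (36 + s * 4))))
          + p * ((26 + s * (28 + s * (32 + s * 8)))
          + p * (4 + s * (4 + s * 4))))))
  certificate = solve-∀

TuránInequality : ℕ → ℕ → Set
TuránInequality n t = a (suc n) 0 * a (n ∸ 1) t + a (n ∸ 1) 0 * a (suc n) t ≥ 2 * (a n 0 * a n t)

turán-below-diagonal : ∀ t p → TuránInequality (suc (t + p)) t
turán-below-diagonal t p = 2z≤x₁+x₂-by-proportions
  (≐-* (a[n+1,0]-ratio (suc (t + p))) (a[n+1,k]-ratio t p refl))
  (≐-* (≐-sym (a[n+1,0]-ratio (t + p))) (≐-sym (a[n+1,k]-ratio t (suc p) (+-suc t p))))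
  (ratio-sum-≥-2 t p)

-- The first term, a(n+1,0)·a(n−1,n), is zero and is simply dropped.
turán-on-diagonal : ∀ q → TuránInequality (suc q) (suc q)
turán-on-diagonal q = begin
  2 * (a (suc q) 0 * w)                    ≡⟨ cong (λ x → 2 * (x * w)) (a[n,0]≡centralBinom (suc q)) ⟩
  2 * (centralBinom (suc q) * w)           ≤⟨ *-monoʳ-≤ 2 (*-monoˡ-≤ w (centralBinom[k+1]≤[k+2]*centralBinom[k] q)) ⟩
  2 * (suc (suc q) * centralBinom q * w)   ≡⟨ regroup (suc (suc q)) (centralBinom q) w ⟩
  centralBinom q * (suc (suc q) * 2 * w)   ≡⟨ cong₂ _*_ (sym (a[n,0]≡centralBinom q)) a[q+2,q+1] ⟩
  a q 0 * a (suc (suc q)) (suc q)          ≤⟨ m≤n+m _ _ ⟩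
  a (suc (suc q)) 0 * a q (suc q) + a q 0 * a (suc (suc q)) (suc q) ∎
  where
  open ≤-Reasoning
  w = a (suc q) (suc q)
  regroup : ∀ m c w → 2 * (m * c * w) ≡ c * (m * 2 * w)
  regroup = solve-∀
  a[q+2,q+1] : suc (suc q) * 2 * w ≡ a (suc (suc q)) (suc q)
  a[q+2,q+1] = trans (scaled-≡ (a[n+1,k]-ratio (suc q) 0 (+-identityʳ (suc q)))) (*-identityˡ _)

proposition3p4 : (n t : ℕ) → 1 ≤ n → t ≤ n →
    a (suc n) 0 * a (n ∸ 1) t + a (n ∸ 1) 0 * a (suc n) t ≥ 2 * (a n 0 * a n t)
proposition3p4 (suc q) t _ t≤1+q with m≤n⇒m<n∨m≡n t≤1+q
... | inj₂ refl = turán-on-diagonal q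
... | inj₁ (s≤s t≤q) with m≤n⇒∃[o]m+o≡n t≤q
...   | p , refl = turán-below-diagonal t p
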